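{- Let $\mathbf{C}$ be a category with a terminal object $1$, let $G:\mathbf{C}\to\mathbf{C}$ be a functor, let $(M,\eta,\mu)$ be a monad on $\mathbf{C}$, and let $\alpha:G\to M$ be a natural transformation. Define natural transformations $\alpha_n:G^n\to M$ for $n<\omega$ recursively by $\alpha_0=\eta$ and $\alpha_{n+1}=\mu\circ\alpha M\circ G\alpha_n$ (i.e. $(\alpha_{n+1})_Y=\mu_Y\circ\alpha_{MY}\circ G((\alpha_n)_Y)$). Then for every $G$-coalgebra $\gamma:X\to GX$ and every $n<\omega$, $$M!_X\circ\gamma^{(n)}=(\alpha_n)_1\circ\gamma_n ,$$ where $!_X:X\to 1$ is the unique morphism.
   Context: Here $G^n$ is the $n$-fold composite of $G$. For a morphism $f:X\to MY$, its Kleisli extension is $f^*=\mu_Y\circ Mf:MX\to MY$. For a $G$-coalgebra $\gamma:X\to GX$: the iterations $\gamma^{(n)}:X\to MX$ are defined by $\gamma^{(0)}=\eta_X$ and $\gamma^{(n+1)}=(\alpha_X\circ\gamma)^*\circ\gamma^{(n)}$; the canonical cone $\gamma_n:X\to G^n1$ is defined by $\gamma_0=!_X:X\to 1$ and $\gamma_{n+1}=G(\gamma_n)\circ\gamma$. -}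

module Defs where

open import Level using (Level; _⊔_) renaming (suc to lsuc)
open import Data.Nat using (ℕ; zero; suc)
open import Relation.Binary.PropositionalEquality using (_≡_)

record Category (o h : Level) : Set (lsuc (o ⊔ h)) where
  infixr 9 _∘_
  field
    Obj  : Set o
    Hom  : Obj → Obj → Set h
    id   : ∀ {A} → Hom A A
    _∘_  : ∀ {A B C} → Hom B C → Hom A B → Hom A C
    identityˡ : ∀ {A B} (f : Hom A B) → id ∘ f ≡ f
    identityʳ : ∀ {A B} (f : Hom A B) → f ∘ id ≡ f
    assoc : ∀ {A B C D} (f : Hom A B) (g : Hom B C) (k : Hom C D) →
            (k ∘ g) ∘ f ≡ k ∘ (g ∘ f)

module _ {o h : Level} (C : Category o h) where
  open Category C

  record Terminal : Set (o ⊔ h) where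
    field
      ⊤ : Obj
      ! : (X : Obj) → Hom X ⊤
      !-unique : ∀ {X} (f : Hom X ⊤) → f ≡ ! X

  record Functor : Set (o ⊔ h) where
    field
      F₀ : Obj → Obj
      F₁ : ∀ {A B} → Hom A B → Hom (F₀ A) (F₀ B)
      F-id : ∀ {A} → F₁ (id {A}) ≡ id
      F-∘ : ∀ {A B D} (f : Hom A B) (g : Hom B D) → F₁ (g ∘ f) ≡ F₁ g ∘ F₁ f

  record NatTrans (F G : Functor) : Set (o ⊔ h) where
    open Functor F renaming (F₀ to F₀'; F₁ to F₁')
    open Functor G renaming (F₀ to G₀; F₁ to G₁)
    field
      η : (X : Obj) → Hom (F₀' X) (G₀ X)
      natural : ∀ {X Y} (f : Hom X Y) → G₁ f ∘ η X ≡ η Y ∘ F₁' f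

  record Monad : Set (o ⊔ h) where
    field
      functor : Functor
    open Functor functor public renaming (F₀ to M₀; F₁ to M₁)
    field
      η : (X : Obj) → Hom X (M₀ X)
      μ : (X : Obj) → Hom (M₀ (M₀ X)) (M₀ X)
      η-natural : ∀ {X Y} (f : Hom X Y) → M₁ f ∘ η X ≡ η Y ∘ f
      μ-natural : ∀ {X Y} (f : Hom X Y) → M₁ f ∘ μ X ≡ μ Y ∘ M₁ (M₁ f)
      μ-assoc : ∀ X → μ X ∘ M₁ (μ X) ≡ μ X ∘ μ (M₀ X)
      μ-unitˡ : ∀ X → μ X ∘ η (M₀ X) ≡ id
      μ-unitʳ : ∀ X → μ X ∘ M₁ (η X) ≡ id

  module _ (G : Functor) where
    open Functor G
    Gⁿ₀ : ℕ → Obj → Obj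
    Gⁿ₀ zero X = X
    Gⁿ₀ (suc n) X = F₀ (Gⁿ₀ n X)

    Gⁿ₁ : (n : ℕ) → ∀ {A B} → Hom A B → Hom (Gⁿ₀ n A) (Gⁿ₀ n B)
    Gⁿ₁ zero f = f
    Gⁿ₁ (suc n) f = F₁ (Gⁿ₁ n f)

  module _ (G : Functor) (M : Monad) (α : NatTrans G (Monad.functor M)) where
    open Functor G renaming (F₀ to G₀; F₁ to G₁)
    open Monad M renaming (η to ηᴹ)
    open NatTrans α renaming (η to αc)

    αₙ : (n : ℕ) (Y : Obj) → Hom (Gⁿ₀ G n Y) (M₀ Y)
    αₙ zero Y = ηᴹ Y
    αₙ (suc n) Y = μ Y ∘ (αc (M₀ Y) ∘ G₁ (αₙ n Y))

    kleisli : ∀ {X Y} → Hom X (M₀ Y) → Hom (M₀ X) (M₀ Y)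
    kleisli {X} {Y} f = μ Y ∘ M₁ f

    iterate : ∀ {X} (γ : Hom X (G₀ X)) → ℕ → Hom X (M₀ X)
    iterate {X} γ zero = ηᴹ X
    iterate {X} γ (suc n) = kleisli (αc X ∘ γ) ∘ iterate γ n

  module _ (T : Terminal) (G : Functor) where
    open Terminal T
    open Functor G
    cone : ∀ {X} (γ : Hom X (F₀ X)) → (n : ℕ) → Hom X (Gⁿ₀ G n ⊤)
    cone {X} γ zero = ! X
    cone {X} γ (suc n) = F₁ (cone γ n) ∘ γ

-- Read through the Kleisli extension, the recursion for α_{n+1} becomes
-- (α_{n+1})_Y = (α_n)_Y* ∘ α_{G^n Y}, and the coalgebra iteration can be unfolded
-- from the other end, γ^(n+1) = γ^(n)* ∘ α_X ∘ γ.  Both sides of the claim then grow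
-- by the same Kleisli step, so induction on n closes it, using only naturality of
-- μ and α and the monad laws.
module Submission where

open import Defs
open import Data.Nat using (ℕ; zero; suc)
open import Relation.Binary.PropositionalEquality using (_≡_; sym; trans; cong; module ≡-Reasoning)

module Reassociation {o h} (C : Category o h) where
  open Category C

  pullˡ : ∀ {A B D E} {a : Hom D E} {b : Hom B D} {c : Hom B E} {f : Hom A B} →
          a ∘ b ≡ c → a ∘ (b ∘ f) ≡ c ∘ f
  pullˡ {a = a} {b} {f = f} eq = trans (sym (assoc f b a)) (cong (_∘ f) eq)

  pullʳ : ∀ {A B D E} {a : Hom B D} {b : Hom A B} {c : Hom A D} {f : Hom D E} →
          a ∘ b ≡ c → (f ∘ a) ∘ b ≡ f ∘ c
  pullʳ {a = a} {b} {f = f} eq = trans (assoc b a f) (cong (f ∘_) eq)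

module KleisliLaws {o h} (C : Category o h) (M : Monad C) where
  open Category C
  open Monad M
  open Reassociation C
  open ≡-Reasoning

  infix 10 _*
  _* : ∀ {X Y} → Hom X (M₀ Y) → Hom (M₀ X) (M₀ Y)
  _* {Y = Y} f = μ Y ∘ M₁ f

  *-identityʳ : ∀ {X Y} (f : Hom X (M₀ Y)) → f * ∘ η X ≡ f
  *-identityʳ {X} {Y} f = begin
    (μ Y ∘ M₁ f) ∘ η X   ≡⟨ pullʳ (η-natural f) ⟩
    μ Y ∘ (η (M₀ Y) ∘ f) ≡⟨ pullˡ (μ-unitˡ Y) ⟩
    id ∘ f               ≡⟨ identityˡ f ⟩
    f                    ∎

  η* : ∀ X → η X * ≡ id
  η* = μ-unitʳ

  M₁-∘-* : ∀ {X Y Z} (g : Hom Y Z) (f : Hom X (M₀ Y)) → M₁ g ∘ f * ≡ (M₁ g ∘ f) *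
  M₁-∘-* {Y = Y} {Z} g f = begin
    M₁ g ∘ (μ Y ∘ M₁ f)          ≡⟨ pullˡ (μ-natural g) ⟩
    (μ Z ∘ M₁ (M₁ g)) ∘ M₁ f     ≡⟨ pullʳ (sym (F-∘ f (M₁ g))) ⟩
    μ Z ∘ M₁ (M₁ g ∘ f)          ∎

  *-∘-M₁ : ∀ {X Y Z} (f : Hom Y (M₀ Z)) (g : Hom X Y) → (f ∘ g) * ≡ f * ∘ M₁ g
  *-∘-M₁ {Z = Z} f g = begin
    μ Z ∘ M₁ (f ∘ g)          ≡⟨ cong (μ Z ∘_) (F-∘ g f) ⟩
    μ Z ∘ (M₁ f ∘ M₁ g)       ≡⟨ sym (assoc _ _ _) ⟩
    (μ Z ∘ M₁ f) ∘ M₁ g       ∎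

  *-assoc : ∀ {X Y Z} (f : Hom X (M₀ Y)) (g : Hom Y (M₀ Z)) → (g * ∘ f) * ≡ g * ∘ f *
  *-assoc {Y = Y} {Z} f g = begin
    (g * ∘ f) *                            ≡⟨ *-∘-M₁ (g *) f ⟩
    (μ Z ∘ M₁ (μ Z ∘ M₁ g)) ∘ M₁ f         ≡⟨ cong (λ k → (μ Z ∘ k) ∘ M₁ f) (F-∘ (M₁ g) (μ Z)) ⟩
    (μ Z ∘ (M₁ (μ Z) ∘ M₁ (M₁ g))) ∘ M₁ f  ≡⟨ cong (_∘ M₁ f) (sym (assoc _ _ _)) ⟩
    ((μ Z ∘ M₁ (μ Z)) ∘ M₁ (M₁ g)) ∘ M₁ f  ≡⟨ cong (λ k → (k ∘ M₁ (M₁ g)) ∘ M₁ f) (μ-assoc Z) ⟩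
    ((μ Z ∘ μ (M₀ Z)) ∘ M₁ (M₁ g)) ∘ M₁ f  ≡⟨ cong (_∘ M₁ f) (pullʳ (sym (μ-natural g))) ⟩
    (μ Z ∘ (M₁ g ∘ μ Y)) ∘ M₁ f            ≡⟨ cong (_∘ M₁ f) (sym (assoc _ _ _)) ⟩
    (g * ∘ μ Y) ∘ M₁ f                     ≡⟨ assoc _ _ _ ⟩
    g * ∘ f *                              ∎

module Iteration {o h} (C : Category o h) (G : Functor C) (M : Monad C)
    (α : NatTrans C G (Monad.functor M)) where
  open Category C
  open Functor G renaming (F₀ to G₀; F₁ to G₁)
  open Monad M
  open NatTrans α renaming (η to αc)
  open Reassociation C
  open KleisliLaws C M
  open ≡-Reasoning

  *-∘-α : ∀ {Y Z} (f : Hom Y (M₀ Z)) → f * ∘ αc Y ≡ μ Z ∘ (αc (M₀ Z) ∘ G₁ f)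
  *-∘-α f = pullʳ (natural f)

  αₙ-suc : ∀ n Y → αₙ C G M α (suc n) Y ≡ αₙ C G M α n Y * ∘ αc (Gⁿ₀ C G n Y)
  αₙ-suc n Y = sym (*-∘-α (αₙ C G M α n Y))

  iterate-suc : ∀ {X} (γ : Hom X (G₀ X)) n →
                iterate C G M α γ (suc n) ≡ iterate C G M α γ n * ∘ (αc X ∘ γ)
  iterate-suc {X} γ zero = begin
    (αc X ∘ γ) * ∘ η X   ≡⟨ *-identityʳ (αc X ∘ γ) ⟩
    αc X ∘ γ             ≡⟨ sym (identityˡ _) ⟩
    id ∘ (αc X ∘ γ)      ≡⟨ cong (_∘ (αc X ∘ γ)) (sym (η* X)) ⟩
    η X * ∘ (αc X ∘ γ)   ∎
  iterate-suc {X} γ (suc n) = begin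
    (αc X ∘ γ) * ∘ γ⁽ suc n ⁾            ≡⟨ cong ((αc X ∘ γ) * ∘_) (iterate-suc γ n) ⟩
    (αc X ∘ γ) * ∘ (γ⁽ n ⁾ * ∘ (αc X ∘ γ)) ≡⟨ pullˡ (sym (*-assoc (γ⁽ n ⁾) (αc X ∘ γ))) ⟩
    γ⁽ suc n ⁾ * ∘ (αc X ∘ γ)            ∎
    where γ⁽_⁾ = iterate C G M α γ

module _ {o h} (C : Category o h) (T : Terminal C) (G : Functor C) (M : Monad C)
    (α : NatTrans C G (Monad.functor M)) where
  open Category C
  open Terminal T
  open Functor G renaming (F₁ to G₁)
  open Monad M
  open NatTrans α renaming (η to αc)
  open Reassociation C
  open KleisliLaws C M
  open Iteration C G M α
  open ≡-Reasoning

  M₁!-∘-iterate : ∀ {X} (γ : Hom X (Functor.F₀ G X)) n →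
                  M₁ (! X) ∘ iterate C G M α γ n ≡ αₙ C G M α n ⊤ ∘ cone C T G γ n
  M₁!-∘-iterate {X} γ zero = η-natural (! X)
  M₁!-∘-iterate {X} γ (suc n) = begin
    M₁ (! X) ∘ γ⁽ suc n ⁾                 ≡⟨ cong (M₁ (! X) ∘_) (iterate-suc γ n) ⟩
    M₁ (! X) ∘ (γ⁽ n ⁾ * ∘ (αc X ∘ γ))    ≡⟨ pullˡ (M₁-∘-* (! X) (γ⁽ n ⁾)) ⟩
    (M₁ (! X) ∘ γ⁽ n ⁾) * ∘ (αc X ∘ γ)    ≡⟨ cong (λ f → f * ∘ (αc X ∘ γ)) (M₁!-∘-iterate γ n) ⟩
    (A ∘ c) * ∘ (αc X ∘ γ)                ≡⟨ cong (_∘ (αc X ∘ γ)) (*-∘-M₁ A c) ⟩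
    (A * ∘ M₁ c) ∘ (αc X ∘ γ)             ≡⟨ pullʳ (pullˡ (natural c)) ⟩
    A * ∘ ((αc _ ∘ G₁ c) ∘ γ)             ≡⟨ cong (A * ∘_) (assoc _ _ _) ⟩
    A * ∘ (αc _ ∘ (G₁ c ∘ γ))             ≡⟨ pullˡ (sym (αₙ-suc n ⊤)) ⟩
    αₙ C G M α (suc n) ⊤ ∘ (G₁ c ∘ γ)     ∎
    where
      γ⁽_⁾ = iterate C G M α γ
      A = αₙ C G M α n ⊤
      c = cone C T G γ n

lemma2 : ∀ {o h} (C : Category o h) (T : Terminal C) (G : Functor C) (M : Monad C)
    (α : NatTrans C G (Monad.functor M))
    {X : Category.Obj C} (γ : Category.Hom C X (Functor.F₀ G X)) (n : ℕ) →
    Category._∘_ C (Monad.M₁ M (Terminal.! T X)) (iterate C G M α γ n)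
    ≡ Category._∘_ C (αₙ C G M α n (Terminal.⊤ T)) (cone C T G γ n)
lemma2 C T G M α γ n = M₁!-∘-iterate C T G M α γ n
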